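{- Let $p$ be an odd prime. Let $A=\{1\}$ if $p\equiv 1\pmod 4$ and $A=\{1,-1\}$ if $p\equiv 3\pmod 4$. Let $G$ be the subgroup of the symmetric group on $\mathbb{F}_p$ generated by all permutations $x\mapsto ax^d+c$ with $a\in A$, $c\in\mathbb{F}_p$, and $d$ an integer with $1\le d<p-1$ and $\gcd(d,p-1)=1$. Then $G$ is the full symmetric group on $\mathbb{F}_p$ (isomorphic to $S_p$). -}

module Defs where

open import Data.Nat using (ℕ; _+_; _*_; _∸_; _^_; _≤_; _<_; NonZero)
open import Data.Nat.DivMod using (_mod_; _%_)
open import Data.Nat.GCD using (gcd)
open import Data.Fin using (Fin; toℕ)
open import Data.Product using (_×_)
open import Data.Sum using (_⊎_)
open import Function using (_∘_; id)
open import Relation.Binary.PropositionalEquality using (_≡_)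

-- Elements of 𝔽_p are represented by Fin p (residues 0..p-1), arithmetic mod p.
-- The coefficient set A, with a ∈ 𝔽_p given by its residue in ℕ:
--   a = 1 always allowed; a = -1 (residue p ∸ 1) allowed iff p ≡ 3 (mod 4).
InA : (p : ℕ) → ℕ → Set
InA p a = (a ≡ 1) ⊎ ((p % 4 ≡ 3) × (a ≡ p ∸ 1))

AdmExp : (p : ℕ) → ℕ → Set
AdmExp p d = (1 ≤ d) × (d < p ∸ 1) × (gcd d (p ∸ 1) ≡ 1)

powerMap : (p : ℕ) .{{_ : NonZero p}} → ℕ → ℕ → Fin p → Fin p → Fin p
powerMap p a d c x = (a * toℕ x ^ d + toℕ c) mod p

-- Membership in the subgroup G of Sym(𝔽_p) generated by the maps above
-- (elements are functions considered up to pointwise equality).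
data InG (p : ℕ) .{{_ : NonZero p}} : (Fin p → Fin p) → Set where
  gen  : ∀ a d c → InA p a → AdmExp p d → InG p (powerMap p a d c)
  idG  : InG p id
  comp : ∀ {f g} → InG p f → InG p g → InG p (f ∘ g)
  inv  : ∀ {f g} → InG p f → (∀ x → g (f x) ≡ x) → (∀ x → f (g x) ≡ x) → InG p g
  ext  : ∀ {f g} → InG p f → (∀ x → f x ≡ g x) → InG p g

{-# OPTIONS --safe #-}
module Submission where

-- Besides the translations x ↦ x + c, the group contains the inversion x ↦ x ^ (p - 2), which by
-- Fermat's little theorem is x ↦ 1/x away from 0 and fixes 0, and for p ≡ 3 (mod 4) also x ↦ -x.  Short words in translations and inversion realise, through Möbius
-- maps, the 3-cycle (0 1 2) and the map fixing 0 and 1 and sending x ↦ 1 - x elsewhere.  Read on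
-- the residues 0, …, p - 1, this map and x ↦ -x reverse the blocks [2, p - 1] and [1, p - 1].
-- Translates of the 3-cycle generate the double transpositions (l, l+n+3)(l+1, l+n+2), and removing
-- one from the reversal of a block of length n + 4 leaves the reversal of its inner block of length n.
-- Since p - 2 ≡ 3 (mod 4) when p ≡ 1 and p - 1 ≡ 2 (mod 4) when p ≡ 3, this descent ends in a
-- transposition of two points at distance 2 or 1; a 3-cycle turns the former into an adjacent
-- transposition, whose translates and their conjugates give every transposition, hence every
-- permutation.

open import Defs
open import Data.Nat as ℕ using (ℕ; zero; suc; z≤n; s≤s; NonZero)
import Data.Nat.Properties as ℕ
import Data.Nat.Divisibility as ℕ
open import Data.Nat.DivMod using (_%_; _/_; _mod_; m≤n⇒m%n≡m; m%n<n; m≡m%n+[m/n]*n; [m+kn]%n≡m%n)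
open import Data.Nat.GCD using (gcd; gcd[m,n]∣m; gcd[m,n]∣n; gcd-zeroˡ)
open import Data.Nat.Primality using (Prime; euclidsLemma)
import Data.Nat.Tactic.RingSolver as ℕ-Solver
open import Data.Fin as Fin using (Fin; toℕ)
open import Data.Fin.Properties using (_≟_; toℕ-fromℕ<; toℕ-injective; toℕ<n)
open import Data.Fin.Permutation using (Permutation′; _⟨$⟩ʳ_)
open import Data.Fin.Permutation.Components using (transpose; transpose-inverse)
open import Data.Fin.Permutation.Transposition.List using (eval; decompose; eval-decompose)
open import Data.List using (List; []; _∷_; foldr)
open import Data.List.Relation.Unary.All using (All; []; _∷_)
open import Data.Sum as Sum using (_⊎_; inj₁; inj₂)
open import Data.Product using (_,_; ∃-syntax)
open import Function using (_∘_; id)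
open import Relation.Nullary using (¬_; yes; no; contradiction)
open import Relation.Nullary.Decidable using (dec-true; dec-false)
open import Relation.Binary.Bundles using (Setoid)
open import Relation.Binary.Structures using (IsEquivalence)
open import Relation.Binary.Definitions using (tri<; tri≈; tri>)
open import Relation.Binary.PropositionalEquality

module Binomial where

  open import Data.Nat
  open import Data.Nat.Properties
  open import Data.Nat.Divisibility
  open import Data.Nat.Primality
  open import Data.Nat.Combinatorics using (_C_; nCn≡1; nC1≡n; nCk+nC[k+1]≡[n+1]C[k+1])
  open import Data.Fin as Fin using (toℕ; fromℕ; inject₁)
  open import Data.Fin.Properties using (toℕ-fromℕ; toℕ-inject₁; toℕ<n)
  open import Data.Product using (∃-syntax; _,_; _×_)
  open import Data.Sum using (inj₁; inj₂)
  open import Data.Empty using (⊥-elim)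
  open import Function using (_∘_)
  open import Data.Vec.Functional using (Vector; init; last; tail)
  open import Relation.Binary.PropositionalEquality
  open import Algebra.Properties.CommutativeSemiring.Binomial +-*-commutativeSemiring
    using (binomialExpansion; binomialTerm; theorem)
  import Algebra.Definitions.RawMonoid +-0-rawMonoid as Additive
  import Algebra.Definitions.RawSemiring +-*-rawSemiring as Semiring
  open import Algebra.Properties.Monoid.Sum +-0-monoid using (sum; sum-init-last)
  open import Data.Nat.Tactic.RingSolver using (solve-∀)

  ×≡* : ∀ m n → m Additive.× n ≡ m * n
  ×≡* zero n = refl
  ×≡* (suc m) n = cong (n +_) (×≡* m n)

  ^≡^ : ∀ m n → m Semiring.^ n ≡ m ^ n
  ^≡^ m zero = refl
  ^≡^ m (suc n) = cong (m *_) (^≡^ m n)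

  ∣-sum : ∀ {d n} (t : Vector ℕ n) → (∀ i → d ∣ t i) → d ∣ sum t
  ∣-sum {n = zero} t d∣t = _ ∣0
  ∣-sum {n = suc n} t d∣t = ∣m∣n⇒∣m+n (d∣t Fin.zero) (∣-sum (tail t) (d∣t ∘ Fin.suc))

  [1+k]*[1+n]C[1+k]≡[1+n]*nCk : ∀ n k → suc k * (suc n C suc k) ≡ suc n * (n C k)
  [1+k]*[1+n]C[1+k]≡[1+n]*nCk zero zero = refl
  [1+k]*[1+n]C[1+k]≡[1+n]*nCk zero (suc k) = *-zeroʳ (suc (suc k))
  [1+k]*[1+n]C[1+k]≡[1+n]*nCk (suc n) zero =
    trans (*-identityˡ _) (trans (nC1≡n (suc (suc n))) (sym (*-identityʳ _)))
  [1+k]*[1+n]C[1+k]≡[1+n]*nCk (suc n) (suc k) = begin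
    suc (suc k) * (suc (suc n) C suc (suc k))
      ≡⟨ cong (suc (suc k) *_) (nCk+nC[k+1]≡[n+1]C[k+1] (suc n) (suc k)) ⟨
    suc (suc k) * (a + b)
      ≡⟨ distribute k a b ⟩
    a + (suc k * a + suc (suc k) * b)
      ≡⟨ cong₂ (λ u v → a + (u + v)) ([1+k]*[1+n]C[1+k]≡[1+n]*nCk n k)
                                     ([1+k]*[1+n]C[1+k]≡[1+n]*nCk n (suc k)) ⟩
    a + (suc n * (n C k) + suc n * (n C suc k))
      ≡⟨ cong (a +_) (*-distribˡ-+ (suc n) (n C k) (n C suc k)) ⟨
    a + suc n * (n C k + n C suc k)
      ≡⟨ cong (λ c → a + suc n * c) (nCk+nC[k+1]≡[n+1]C[k+1] n k) ⟩
    suc (suc n) * a ∎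
    where
    open ≡-Reasoning
    a = suc n C suc k
    b = suc n C suc (suc k)
    distribute : ∀ k a b → suc (suc k) * (a + b) ≡ a + (suc k * a + suc (suc k) * b)
    distribute = solve-∀

  p∣pCk : ∀ {p k} → Prime p → 0 < k → k < p → p ∣ p C k
  p∣pCk {suc n} {suc k} p-prime _ k<p with euclidsLemma (suc k) _ p-prime p∣[1+k]*pCk
    where
    p∣[1+k]*pCk : suc n ∣ suc k * (suc n C suc k)
    p∣[1+k]*pCk = divides (n C k) (trans ([1+k]*[1+n]C[1+k]≡[1+n]*nCk n k) (*-comm (suc n) (n C k)))
  ... | inj₁ p∣1+k = ⊥-elim (<⇒≱ k<p (∣⇒≤ p∣1+k))
  ... | inj₂ p∣pCk = p∣pCk

  binomialTerm-at-1 : ∀ x n k → binomialTerm x 1 n k ≡ (n C toℕ k) * x ^ toℕ k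
  binomialTerm-at-1 x n k = begin
    binomialTerm x 1 n k ≡⟨ ×≡* (n C toℕ k) _ ⟩
    (n C toℕ k) * (x Semiring.^ toℕ k * 1 Semiring.^ (n ∸ toℕ k))
      ≡⟨ cong ((n C toℕ k) *_) (cong₂ _*_ (^≡^ x (toℕ k)) (trans (^≡^ 1 (n ∸ toℕ k)) (^-zeroˡ (n ∸ toℕ k)))) ⟩
    (n C toℕ k) * (x ^ toℕ k * 1)
      ≡⟨ cong ((n C toℕ k) *_) (*-identityʳ (x ^ toℕ k)) ⟩
    (n C toℕ k) * x ^ toℕ k ∎
    where open ≡-Reasoning

  freshman's-dream : ∀ {p} → Prime p → ∀ x → ∃[ m ] p ∣ m × (x + 1) ^ p ≡ 1 + m + x ^ p
  freshman's-dream {suc q} p-prime x = sum inner , ∣-sum inner p∣inner , expansion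
    where
    t : Vector ℕ (suc (suc q))
    t = binomialTerm x 1 (suc q)
    inner : Vector ℕ q
    inner = init (tail t)
    p∣inner : ∀ i → suc q ∣ inner i
    p∣inner i rewrite binomialTerm-at-1 x (suc q) (Fin.suc (inject₁ i)) | toℕ-inject₁ i =
      ∣m⇒∣m*n _ (p∣pCk p-prime (s≤s z≤n) (s≤s (toℕ<n i)))
    last-term : last (tail t) ≡ x ^ suc q
    last-term = begin
      last (tail t) ≡⟨ binomialTerm-at-1 x (suc q) (Fin.suc (fromℕ q)) ⟩
      (suc q C suc (toℕ (fromℕ q))) * x ^ suc (toℕ (fromℕ q))
        ≡⟨ cong (λ k → (suc q C suc k) * x ^ suc k) (toℕ-fromℕ q) ⟩
      (suc q C suc q) * x ^ suc q ≡⟨ cong (_* x ^ suc q) (nCn≡1 (suc q)) ⟩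
      1 * x ^ suc q ≡⟨ *-identityˡ _ ⟩
      x ^ suc q ∎
      where open ≡-Reasoning
    expansion : (x + 1) ^ suc q ≡ 1 + sum inner + x ^ suc q
    expansion = begin
      (x + 1) ^ suc q ≡⟨ ^≡^ (x + 1) (suc q) ⟨
      (x + 1) Semiring.^ suc q ≡⟨ theorem (suc q) x 1 ⟩
      binomialExpansion x 1 (suc q)
        ≡⟨ cong₂ _+_ (binomialTerm-at-1 x (suc q) Fin.zero) (sum-init-last (tail t)) ⟩
      1 + (sum inner + last (tail t)) ≡⟨ cong (λ z → 1 + (sum inner + z)) last-term ⟩
      1 + (sum inner + x ^ suc q) ≡⟨ +-assoc 1 (sum inner) (x ^ suc q) ⟨
      1 + sum inner + x ^ suc q ∎
      where open ≡-Reasoning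

open Binomial using (freshman's-dream)

open import Data.Integer as ℤ using (ℤ; +_; _+_; _-_; _*_; -_; ∣_∣)
import Data.Integer.Properties as ℤ
open import Data.Integer.Properties using (pos-+; pos-*; abs-*)
open import Data.Integer.Divisibility.Signed
open import Data.Integer.Tactic.RingSolver using (solve-∀)

module Congruence (n : ℕ) where

  -- A record rather than a synonym, so that a and b can be inferred from a ≋ b.
  infix 4 _≋_
  record _≋_ (a b : ℤ) : Set where
    constructor by-divisibility
    field
      divides-difference : + n ∣ a - b
  open _≋_ public

  ≋-by : ∀ {a b c} → a - b ≡ c → + n ∣ c → a ≋ b
  ≋-by a-b≡c n∣c = by-divisibility (subst (+ n ∣_) (sym a-b≡c) n∣c)

  ≋-multiple : ∀ {a b} k → a - b ≡ k * + n → a ≋ b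
  ≋-multiple k a-b≡kn = by-divisibility (divides k a-b≡kn)

  ≋-reflexive : ∀ {a b} → a ≡ b → a ≋ b
  ≋-reflexive {a} refl = ≋-multiple (+ 0) (identity a (+ n))
    where
    identity : ∀ a m → a - a ≡ + 0 * m
    identity = solve-∀

  ≋-refl : ∀ {a} → a ≋ a
  ≋-refl = ≋-reflexive refl

  ≋-sym : ∀ {a b} → a ≋ b → b ≋ a
  ≋-sym {a} {b} (by-divisibility n∣a-b) = ≋-by (identity a b) (∣m⇒∣-m n∣a-b)
    where
    identity : ∀ a b → b - a ≡ - (a - b)
    identity = solve-∀

  ≋-trans : ∀ {a b c} → a ≋ b → b ≋ c → a ≋ c
  ≋-trans {a} {b} {c} (by-divisibility n∣a-b) (by-divisibility n∣b-c) =
    ≋-by (identity a b c) (∣m∣n⇒∣m+n n∣a-b n∣b-c)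
    where
    identity : ∀ a b c → a - c ≡ (a - b) + (b - c)
    identity = solve-∀

  ≋-isEquivalence : IsEquivalence _≋_
  ≋-isEquivalence = record { refl = ≋-refl ; sym = ≋-sym ; trans = ≋-trans }

  ≋-setoid : Setoid _ _
  ≋-setoid = record { isEquivalence = ≋-isEquivalence }

  ≋-from-multiple : ∀ {A B a b} c → A ≋ B → a - b ≡ c * (A - B) → a ≋ b
  ≋-from-multiple c (by-divisibility n∣A-B) eq = ≋-by eq (∣n⇒∣m*n c n∣A-B)

  ≋-from-combination : ∀ {A B C D a b} c d → A ≋ B → C ≋ D →
                       a - b ≡ c * (A - B) + d * (C - D) → a ≋ b
  ≋-from-combination c d (by-divisibility n∣A-B) (by-divisibility n∣C-D) eq =
    ≋-by eq (∣m∣n⇒∣m+n (∣n⇒∣m*n c n∣A-B) (∣n⇒∣m*n d n∣C-D))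

  +-cong : ∀ {a b c d} → a ≋ b → c ≋ d → a + c ≋ b + d
  +-cong {a} {b} {c} {d} a≋b c≋d = ≋-from-combination (+ 1) (+ 1) a≋b c≋d (identity a b c d)
    where
    identity : ∀ a b c d → (a + c) - (b + d) ≡ + 1 * (a - b) + + 1 * (c - d)
    identity = solve-∀

  *-cong : ∀ {a b c d} → a ≋ b → c ≋ d → a * c ≋ b * d
  *-cong {a} {b} {c} {d} a≋b c≋d = ≋-from-combination c b a≋b c≋d (identity a b c d)
    where
    identity : ∀ a b c d → a * c - b * d ≡ c * (a - b) + b * (c - d)
    identity = solve-∀

  n≋0 : + n ≋ + 0
  n≋0 = ≋-multiple (+ 1) (identity (+ n))
    where
    identity : ∀ m → m - + 0 ≡ + 1 * m
    identity = solve-∀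

  +-%-≋ : ∀ m .{{_ : NonZero n}} → + (m % n) ≋ + m
  +-%-≋ m = ≋-multiple (- + (m / n)) (begin
    + (m % n) - + m
      ≡⟨ cong (λ k → + (m % n) - + k) (m≡m%n+[m/n]*n m n) ⟩
    + (m % n) - + (m % n ℕ.+ m / n ℕ.* n)
      ≡⟨ cong (λ k → + (m % n) - k) (trans (pos-+ (m % n) _) (cong (_+_ (+ (m % n))) (pos-* (m / n) n))) ⟩
    + (m % n) - (+ (m % n) + + (m / n) * + n)
      ≡⟨ identity (+ (m % n)) (+ (m / n)) (+ n) ⟩
    - + (m / n) * + n ∎)
    where
    open ≡-Reasoning
    identity : ∀ r q m → r - (r + q * m) ≡ - q * m
    identity = solve-∀

  private
    +[a+k]-+a≡+k : ∀ a k → + (a ℕ.+ k) - + a ≡ + k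
    +[a+k]-+a≡+k a k = trans (cong (_- + a) (pos-+ a k)) (identity (+ a) (+ k))
      where
      identity : ∀ a k → a + k - a ≡ k
      identity = solve-∀

    ≋-canonical-≤ : ∀ {a b} → a ℕ.≤ b → b ℕ.< n → + b ≋ + a → b ≡ a
    ≋-canonical-≤ {a} a≤b b<n b≋a with ℕ.m≤n⇒∃[o]m+o≡n a≤b
    ... | k , refl with ∣⇒∣ᵤ (subst (+ n ∣_) (+[a+k]-+a≡+k a k) (divides-difference b≋a))
    ...   | n∣k with k
    ...     | ℕ.zero = ℕ.+-identityʳ a
    ...     | suc j = contradiction (ℕ.∣⇒≤ n∣k) (ℕ.<⇒≱ (ℕ.≤-<-trans (ℕ.m≤n+m (suc j) a) b<n))

  ≋-canonical : ∀ {a b} → a ℕ.< n → b ℕ.< n → + a ≋ + b → a ≡ b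
  ≋-canonical {a} {b} a<n b<n a≋b with ℕ.≤-total a b
  ... | inj₁ a≤b = sym (≋-canonical-≤ a≤b b<n (≋-sym a≋b))
  ... | inj₂ b≤a = ≋-canonical-≤ b≤a a<n a≋b

x^p≡x*[x*x^[p∸2]] : ∀ {p} → Prime p → ∀ x → x ℕ.^ p ≡ x ℕ.* (x ℕ.* x ℕ.^ (p ℕ.∸ 2))
x^p≡x*[x*x^[p∸2]] {suc (suc _)} _ x = refl

module _ {p : ℕ} (p-prime : Prime p) where

  open Congruence p

  fermat : ∀ x → + (x ℕ.^ p) ≋ + x
  fermat zero = ≋-reflexive (cong +_ (0^p≡0 p-prime))
    where
    0^p≡0 : ∀ {p} → Prime p → 0 ℕ.^ p ≡ 0
    0^p≡0 {suc _} _ = refl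
  fermat (suc x) with freshman's-dream p-prime x
  ... | m , p∣m , expansion = begin
    + (suc x ℕ.^ p)             ≡⟨ cong (λ y → + (y ℕ.^ p)) (ℕ.+-comm 1 x) ⟩
    + ((x ℕ.+ 1) ℕ.^ p)         ≡⟨ cong +_ expansion ⟩
    + (1 ℕ.+ m ℕ.+ x ℕ.^ p)     ≡⟨ trans (pos-+ (1 ℕ.+ m) _) (cong (_+ + (x ℕ.^ p)) (pos-+ 1 m)) ⟩
    + 1 + + m + + (x ℕ.^ p)     ≈⟨ +-cong (+-cong (≋-refl {+ 1}) m≋0) (fermat x) ⟩
    + 1 + + 0 + + x             ≡⟨ sym (pos-+ 1 x) ⟩
    + (suc x) ∎
    where
    open import Relation.Binary.Reasoning.Setoid ≋-setoid
    m≋0 : + m ≋ + 0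
    m≋0 = ≋-by (ℤ.+-identityʳ (+ m)) (∣ᵤ⇒∣ p∣m)

  fermat-inverse : ∀ x → ¬ p ℕ.∣ x → + x * + (x ℕ.^ (p ℕ.∸ 2)) ≋ + 1
  fermat-inverse x p∤x with euclidsLemma x ∣ y - + 1 ∣ p-prime p∣x*∣y-1∣
    where
    y = + x * + (x ℕ.^ (p ℕ.∸ 2))
    x*y≋x : + x * y ≋ + x
    x*y≋x = ≋-trans (≋-reflexive (sym x^p≡x*y)) (fermat x)
      where
      x^p≡x*y : + (x ℕ.^ p) ≡ + x * y
      x^p≡x*y = trans (cong +_ (x^p≡x*[x*x^[p∸2]] p-prime x))
                      (trans (pos-* x _) (cong (+ x *_) (pos-* x _)))
    p∣x*∣y-1∣ : p ℕ.∣ x ℕ.* ∣ y - + 1 ∣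
    p∣x*∣y-1∣ = subst (p ℕ.∣_) (abs-* (+ x) (y - + 1))
      (∣⇒∣ᵤ (subst (+ p ∣_) (identity (+ x) y) (divides-difference x*y≋x)))
      where
      identity : ∀ x y → x * y - x ≡ x * (y - + 1)
      identity = solve-∀
  ... | inj₁ p∣x = contradiction p∣x p∤x
  ... | inj₂ p∣∣y-1∣ = by-divisibility (∣ᵤ⇒∣ p∣∣y-1∣)

module _ {n : ℕ} where

  transpose-elim : ∀ (P : Fin n → Set) (i j k : Fin n) →
                   (k ≡ i → P j) → (k ≡ j → P i) → (k ≢ i → k ≢ j → P k) → P (transpose i j k)
  transpose-elim P i j k k≡i k≡j k≢i,j with k ≟ i
  ... | yes refl = k≡i refl
  ... | no k≢i with k ≟ j
  ...   | yes refl = k≡j refl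
  ...   | no k≢j = k≢i,j k≢i k≢j

  transpose-left : ∀ (i j : Fin n) → transpose i j i ≡ j
  transpose-left i j rewrite dec-true (i ≟ i) refl = refl

  transpose-right : ∀ (i j : Fin n) → transpose i j j ≡ i
  transpose-right i j = transpose-elim (_≡ i) i j j id (λ _ → refl) (λ _ j≢j → contradiction refl j≢j)

  transpose-apart : ∀ {i j k : Fin n} → k ≢ i → k ≢ j → transpose i j k ≡ k
  transpose-apart {i} {j} {k} k≢i k≢j rewrite dec-false (k ≟ i) k≢i | dec-false (k ≟ j) k≢j = refl

  transpose-comm : ∀ (i j k : Fin n) → transpose i j k ≡ transpose j i k
  transpose-comm i j k = transpose-elim (λ l → l ≡ transpose j i k) i j k
    (λ { refl → sym (transpose-right j i) })
    (λ { refl → sym (transpose-left j i) })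
    (λ k≢i k≢j → sym (transpose-apart k≢j k≢i))

  transpose-involutive : ∀ (i j k : Fin n) → transpose i j (transpose i j k) ≡ k
  transpose-involutive i j k = trans (cong (transpose i j) (transpose-comm i j k)) (transpose-inverse i j)

  transpose-same : ∀ (i k : Fin n) → transpose i i k ≡ k
  transpose-same i k = transpose-elim (_≡ k) i i k sym sym (λ _ _ → refl)

  transpose-conj : ∀ (σ σ⁻¹ : Fin n → Fin n) → (∀ x → σ⁻¹ (σ x) ≡ x) → (∀ x → σ (σ⁻¹ x) ≡ x) →
                   ∀ i j x → σ (transpose i j (σ⁻¹ x)) ≡ transpose (σ i) (σ j) x
  transpose-conj σ σ⁻¹ left right i j x = transpose-elim (λ l → σ l ≡ τ x) i j (σ⁻¹ x)
    (λ σ⁻¹x≡i → trans (sym (transpose-left (σ i) (σ j))) (cong τ (σ-of σ⁻¹x≡i)))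
    (λ σ⁻¹x≡j → trans (sym (transpose-right (σ i) (σ j))) (cong τ (σ-of σ⁻¹x≡j)))
    (λ σ⁻¹x≢i σ⁻¹x≢j → trans (right x) (sym (transpose-apart (≢σ σ⁻¹x≢i) (≢σ σ⁻¹x≢j))))
    where
    τ = transpose (σ i) (σ j)
    σ-of : ∀ {l} → σ⁻¹ x ≡ l → σ l ≡ x
    σ-of σ⁻¹x≡l = trans (cong σ (sym σ⁻¹x≡l)) (right x)
    ≢σ : ∀ {l} → σ⁻¹ x ≢ l → x ≢ σ l
    ≢σ σ⁻¹x≢l x≡σl = σ⁻¹x≢l (trans (cong σ⁻¹ x≡σl) (left _))

module _ {p : ℕ} .{{_ : NonZero p}} where

  ∈G-conj : ∀ {f σ} σ⁻¹ → InG p σ → (∀ x → σ⁻¹ (σ x) ≡ x) → (∀ x → σ (σ⁻¹ x) ≡ x) →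
            InG p f → InG p (σ ∘ f ∘ σ⁻¹)
  ∈G-conj σ⁻¹ σ∈G left right f∈G = comp (comp σ∈G f∈G) (inv σ∈G left right)

  ∈G-reverse : ∀ {f g} → (∀ x → f (f x) ≡ x) → (∀ x → g (g x) ≡ x) →
               InG p (f ∘ g) → InG p (g ∘ f)
  ∈G-reverse {f} {g} f-inv g-inv fg∈G =
    inv fg∈G (λ x → trans (cong g (f-inv (g x))) (g-inv x)) (λ x → trans (cong f (g-inv (f x))) (f-inv x))

  permutation∈G : (∀ i j → InG p (transpose i j)) → (σ : Permutation′ p) → InG p (σ ⟨$⟩ʳ_)
  permutation∈G transpose∈G σ = ext (eval∈G (decompose σ)) (eval-decompose σ)
    where
    eval∈G : ∀ xs → InG p (eval xs ⟨$⟩ʳ_)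
    eval∈G [] = idG
    eval∈G ((i , j) ∷ xs) = comp (eval∈G xs) (transpose∈G i j)

[k+q*4]%2≡k%2 : ∀ k q → (k ℕ.+ q ℕ.* 4) % 2 ≡ k % 2
[k+q*4]%2≡k%2 k q =
  trans (cong (λ n → (k ℕ.+ n) % 2) (sym (ℕ.*-assoc q 2 2))) ([m+kn]%n≡m%n k (q ℕ.* 2) 2)

odd⇒r≡4q∨4q+2 : ∀ r → (3 ℕ.+ r) % 2 ≡ 1 → ∃[ q ] (r ≡ q ℕ.* 4 ⊎ r ≡ q ℕ.* 4 ℕ.+ 2)
odd⇒r≡4q∨4q+2 r odd with r % 4 | m%n<n r 4 | m≡m%n+[m/n]*n r 4
... | 0 | _ | r≡4q = r / 4 , inj₁ r≡4q
... | 1 | _ | r≡1+4q =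
  contradiction (trans (sym ([k+q*4]%2≡k%2 4 (r / 4))) (subst (λ n → (3 ℕ.+ n) % 2 ≡ 1) r≡1+4q odd)) (λ ())
... | 2 | _ | r≡2+4q = r / 4 , inj₂ (trans r≡2+4q (ℕ.+-comm 2 _))
... | 3 | _ | r≡3+4q =
  contradiction (trans (sym ([k+q*4]%2≡k%2 6 (r / 4))) (subst (λ n → (3 ℕ.+ n) % 2 ≡ 1) r≡3+4q odd)) (λ ())
... | suc (suc (suc (suc _))) | s≤s (s≤s (s≤s (s≤s ()))) | _

gcd[n,1+n]≡1 : ∀ n → gcd n (suc n) ≡ 1
gcd[n,1+n]≡1 n = ℕ.∣1⇒≡1 (ℕ.∣m+n∣m⇒∣n g∣n+1 (gcd[m,n]∣m n (suc n)))
  where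
  g∣n+1 : gcd n (suc n) ℕ.∣ n ℕ.+ 1
  g∣n+1 = subst (gcd n (suc n) ℕ.∣_) (ℕ.+-comm 1 n) (gcd[m,n]∣n n (suc n))

module OddPrime (r : ℕ) (p-prime : Prime (suc (suc (suc r)))) where

  p : ℕ
  p = suc (suc (suc r))

  open Congruence p

  ⟦_⟧ : Fin p → ℤ
  ⟦ x ⟧ = + toℕ x

  ⟦mod⟧ : ∀ n → ⟦ n mod p ⟧ ≋ + n
  ⟦mod⟧ n = ≋-trans (≋-reflexive (cong +_ (toℕ-fromℕ< _))) (+-%-≋ n)

  -- ι, the generators and `swap` are opaque: normalising `_mod_` or `transpose` on open terms
  -- makes type checking prohibitively slow.
  opaque
    ι : ℕ → Fin p
    ι n = n mod p

    ⟦ι⟧ : ∀ n → ⟦ ι n ⟧ ≋ + n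
    ⟦ι⟧ = ⟦mod⟧

    toℕ-ι : ∀ {n} → n ℕ.< p → toℕ (ι n) ≡ n
    toℕ-ι (s≤s n≤) = trans (toℕ-fromℕ< _) (m≤n⇒m%n≡m n≤)

  ι-toℕ : ∀ x → ι (toℕ x) ≡ x
  ι-toℕ x = toℕ-injective (toℕ-ι (toℕ<n x))

  ⟦⟧-injective : ∀ {x y} → ⟦ x ⟧ ≋ ⟦ y ⟧ → x ≡ y
  ⟦⟧-injective {x} {y} x≋y = toℕ-injective (≋-canonical (toℕ<n x) (toℕ<n y) x≋y)

  ≋⇒≡ι : ∀ {x n} → ⟦ x ⟧ ≋ + n → x ≡ ι n
  ≋⇒≡ι {x} {n} x≋n = ⟦⟧-injective (≋-trans x≋n (≋-sym (⟦ι⟧ n)))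

  ≡ι : ∀ {x a} → toℕ x ≡ a → x ≡ ι a
  ≡ι {x} x≡a = trans (sym (ι-toℕ x)) (cong ι x≡a)

  ≢ι : ∀ {x m} → m ℕ.< p → toℕ x ≢ m → x ≢ ι m
  ≢ι m<p x≢m x≡ιm = x≢m (trans (cong toℕ x≡ιm) (toℕ-ι m<p))

  ι-apart : ∀ {c d} → c ℕ.< p → c ≢ d → toℕ (ι c) ≢ d
  ι-apart c<p c≢d = subst (_≢ _) (sym (toℕ-ι c<p)) c≢d

  >⇒≉ : ∀ {x k} → k ℕ.< toℕ x → ¬ ⟦ x ⟧ ≋ + k
  >⇒≉ {x} k<x x≋k = ℕ.<⇒≢ k<x (sym (≋-canonical (toℕ<n x) (ℕ.<-trans k<x (toℕ<n x)) x≋k))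

  0≉1 : ¬ + 0 ≋ + 1
  0≉1 0≋1 = contradiction (≋-canonical (s≤s z≤n) (s≤s (s≤s z≤n)) 0≋1) (λ ())

  a≉k⇒a-k≉0 : ∀ {a} k → ¬ a ≋ + k → ¬ a - + k ≋ + 0
  a≉k⇒a-k≉0 {a} k a≉k a-k≋0 = a≉k (≋-from-multiple (+ 1) a-k≋0 (identity a (+ k)))
    where
    identity : ∀ a k → a - k ≡ + 1 * (a - k - + 0)
    identity = solve-∀

  +[p∸k]≋-k : ∀ {k} → k ℕ.≤ p → + (p ℕ.∸ k) ≋ - + k
  +[p∸k]≋-k {k} k≤p = ≋-multiple (+ 1) (begin
    + (p ℕ.∸ k) - - + k   ≡⟨ identity (+ (p ℕ.∸ k)) (+ k) ⟩
    + (p ℕ.∸ k) + + k     ≡⟨ pos-+ (p ℕ.∸ k) k ⟨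
    + (p ℕ.∸ k ℕ.+ k)     ≡⟨ cong +_ (ℕ.m∸n+n≡m k≤p) ⟩
    + p                   ≡⟨ ℤ.*-identityˡ (+ p) ⟨
    + 1 * + p ∎)
    where
    open ≡-Reasoning
    identity : ∀ a b → a - - b ≡ a + b
    identity = solve-∀

  2<p : 2 ℕ.< p
  2<p = s≤s (s≤s (s≤s z≤n))

  1-admissible : AdmExp p 1
  1-admissible = s≤s z≤n , s≤s (s≤s z≤n) , gcd-zeroˡ (p ℕ.∸ 1)

  [p∸2]-admissible : AdmExp p (p ℕ.∸ 2)
  [p∸2]-admissible = s≤s z≤n , ℕ.≤-refl , gcd[n,1+n]≡1 (suc r)

  opaque
    translate : ℕ → Fin p → Fin p
    translate n = powerMap p 1 1 (ι n)

    invert : Fin p → Fin p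
    invert = powerMap p 1 (p ℕ.∸ 2) Fin.zero

    negate : Fin p → Fin p
    negate = powerMap p (p ℕ.∸ 1) 1 Fin.zero

    translate∈G : ∀ n → InG p (translate n)
    translate∈G n = gen 1 1 (ι n) (inj₁ refl) 1-admissible

    invert∈G : InG p invert
    invert∈G = gen 1 (p ℕ.∸ 2) Fin.zero (inj₁ refl) [p∸2]-admissible

    negate∈G : p % 4 ≡ 3 → InG p negate
    negate∈G p≡3 = gen (p ℕ.∸ 1) 1 Fin.zero (inj₂ (p≡3 , refl)) 1-admissible

    ⟦translate⟧ : ∀ n {x a} → ⟦ x ⟧ ≋ a → ⟦ translate n x ⟧ ≋ a + + n
    ⟦translate⟧ n {x} {a} x≋a = begin
      ⟦ translate n x ⟧                      ≈⟨ ⟦mod⟧ _ ⟩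
      + (1 ℕ.* (toℕ x ℕ.* 1) ℕ.+ toℕ (ι n))  ≡⟨ cong (λ t → + (t ℕ.+ toℕ (ι n))) (ℕ.*-identityˡ _) ⟩
      + (toℕ x ℕ.* 1 ℕ.+ toℕ (ι n))          ≡⟨ cong (λ t → + (t ℕ.+ toℕ (ι n))) (ℕ.*-identityʳ _) ⟩
      + (toℕ x ℕ.+ toℕ (ι n))                ≡⟨ pos-+ (toℕ x) (toℕ (ι n)) ⟩
      ⟦ x ⟧ + ⟦ ι n ⟧                        ≈⟨ +-cong x≋a (⟦ι⟧ n) ⟩
      a + + n ∎
      where open import Relation.Binary.Reasoning.Setoid ≋-setoid

    ⟦negate⟧ : ∀ x → ⟦ negate x ⟧ ≋ - ⟦ x ⟧
    ⟦negate⟧ x = begin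
      ⟦ negate x ⟧                                     ≈⟨ ⟦mod⟧ _ ⟩
      + ((p ℕ.∸ 1) ℕ.* (toℕ x ℕ.* 1) ℕ.+ 0)            ≡⟨ cong +_ (ℕ.+-identityʳ _) ⟩
      + (suc (suc r) ℕ.* (toℕ x ℕ.* 1))                ≡⟨ cong (λ t → + (suc (suc r) ℕ.* t)) (ℕ.*-identityʳ (toℕ x)) ⟩
      + (suc (suc r) ℕ.* toℕ x)                        ≡⟨ pos-* (suc (suc r)) (toℕ x) ⟩
      + suc (suc r) * ⟦ x ⟧                            ≈⟨ *-cong (+[p∸k]≋-k (s≤s z≤n)) ≋-refl ⟩
      - + 1 * ⟦ x ⟧                                    ≡⟨ ℤ.-1*i≡-i ⟦ x ⟧ ⟩
      - ⟦ x ⟧ ∎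
      where open import Relation.Binary.Reasoning.Setoid ≋-setoid

    ⟦invert⟧ : ∀ x → ⟦ invert x ⟧ ≋ + (toℕ x ℕ.^ (p ℕ.∸ 2))
    ⟦invert⟧ x = ≋-trans (⟦mod⟧ _) (≋-reflexive (cong +_ (trans (ℕ.+-identityʳ _) (ℕ.*-identityˡ _))))

  invert-inverse : ∀ {x a} → ⟦ x ⟧ ≋ a → ¬ a ≋ + 0 → a * ⟦ invert x ⟧ ≋ + 1
  invert-inverse {x} x≋a a≉0 =
    ≋-trans (*-cong (≋-sym x≋a) (⟦invert⟧ x)) (fermat-inverse p-prime (toℕ x) p∤x)
    where
    p∤x : ¬ p ℕ.∣ toℕ x
    p∤x p∣x = a≉0 (≋-trans (≋-sym x≋a) (≋-by (ℤ.+-identityʳ ⟦ x ⟧) (∣ᵤ⇒∣ p∣x)))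

  invert-unique : ∀ {x a b} → ⟦ x ⟧ ≋ a → a * b ≋ + 1 → ⟦ invert x ⟧ ≋ b
  invert-unique {x} {a} {b} x≋a ab≋1 = ≋-from-combination (- c) b ab≋1 ac≋1 (identity a b c)
    where
    c = ⟦ invert x ⟧
    a≉0 : ¬ a ≋ + 0
    a≉0 a≋0 = 0≉1 (≋-trans (≋-sym (≋-trans (*-cong a≋0 (≋-refl {b})) (≋-reflexive (ℤ.*-zeroˡ b)))) ab≋1)
    ac≋1 : a * c ≋ + 1
    ac≋1 = invert-inverse x≋a a≉0
    identity : ∀ a b c → c - b ≡ - c * (a * b - + 1) + b * (a * c - + 1)
    identity = solve-∀

  invert-0 : ∀ {x} → ⟦ x ⟧ ≋ + 0 → ⟦ invert x ⟧ ≋ + 0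
  invert-0 {x} x≋0 = ≋-trans (⟦invert⟧ x)
    (≋-reflexive (cong (λ t → + (t ℕ.^ (p ℕ.∸ 2))) (≋-canonical (toℕ<n x) (s≤s z≤n) x≋0)))

  translate⁻¹ : ℕ → Fin p → Fin p
  translate⁻¹ k = translate ((p ℕ.∸ 1) ℕ.* k)

  ⟦translate⁻¹⟧ : ∀ k {x a} → ⟦ x ⟧ ≋ a → ⟦ translate⁻¹ k x ⟧ ≋ a - + k
  ⟦translate⁻¹⟧ k {x} {a} x≋a = begin
    ⟦ translate⁻¹ k x ⟧                 ≈⟨ ⟦translate⟧ _ x≋a ⟩
    a + + ((p ℕ.∸ 1) ℕ.* k)             ≡⟨ cong (_+_ a) (pos-* (p ℕ.∸ 1) k) ⟩
    a + + (p ℕ.∸ 1) * + k               ≈⟨ +-cong (≋-refl {a}) (*-cong (+[p∸k]≋-k (s≤s z≤n)) (≋-refl {+ k})) ⟩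
    a + - + 1 * + k                     ≡⟨ cong (_+_ a) (ℤ.-1*i≡-i (+ k)) ⟩
    a - + k ∎
    where open import Relation.Binary.Reasoning.Setoid ≋-setoid

  translate⁻¹-translate : ∀ k x → translate⁻¹ k (translate k x) ≡ x
  translate⁻¹-translate k x =
    ⟦⟧-injective (≋-trans (⟦translate⁻¹⟧ k (⟦translate⟧ k {x} ≋-refl)) (≋-reflexive (identity ⟦ x ⟧ (+ k))))
    where
    identity : ∀ a k → a + k - k ≡ a
    identity = solve-∀

  translate-translate⁻¹ : ∀ k x → translate k (translate⁻¹ k x) ≡ x
  translate-translate⁻¹ k x =
    ⟦⟧-injective (≋-trans (⟦translate⟧ k (⟦translate⁻¹⟧ k {x} ≋-refl)) (≋-reflexive (identity ⟦ x ⟧ (+ k))))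
    where
    identity : ∀ a k → a - k + k ≡ a
    identity = solve-∀

  translate-ι : ∀ k a → translate k (ι a) ≡ ι (a ℕ.+ k)
  translate-ι k a = ≋⇒≡ι (≋-trans (⟦translate⟧ k (⟦ι⟧ a)) (≋-reflexive (sym (pos-+ a k))))

  translate⁻¹-ι : ∀ k a → translate⁻¹ k (ι (a ℕ.+ k)) ≡ ι a
  translate⁻¹-ι k a = ≋⇒≡ι (≋-trans (⟦translate⁻¹⟧ k (⟦ι⟧ (a ℕ.+ k)))
                                    (≋-reflexive (trans (cong (_- + k) (pos-+ a k)) (identity (+ a) (+ k)))))
    where
    identity : ∀ a k → a + k - k ≡ a
    identity = solve-∀

  word : List (Fin p → Fin p) → Fin p → Fin p
  word = foldr (λ f g → f ∘ g) id

  word∈G : ∀ {fs} → All (InG p) fs → InG p (word fs)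
  word∈G [] = idG
  word∈G (f∈G ∷ fs∈G) = comp f∈G (word∈G fs∈G)

  -- Away from 0 and 1 this acts as  x ↦ x - 1 ↦ 1/(x - 1) ↦ x/(x - 1) ↦ (x - 1)/x ↦ -1/x ↦ -x ↦ 1 - x.
  reflection : Fin p → Fin p
  reflection = word (translate 1 ∷ invert ∷ translate⁻¹ 1 ∷ invert ∷
                     translate 1 ∷ invert ∷ translate⁻¹ 1 ∷ [])

  reflection∈G : InG p reflection
  reflection∈G = word∈G (translate∈G 1 ∷ invert∈G ∷ translate∈G _ ∷ invert∈G ∷
                         translate∈G 1 ∷ invert∈G ∷ translate∈G _ ∷ [])

  reflection-0 : ∀ {x} → ⟦ x ⟧ ≋ + 0 → ⟦ reflection x ⟧ ≋ + 0
  reflection-0 x≋0 =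
    ⟦translate⟧ 1 (invert-unique {b = - + 1} (⟦translate⁻¹⟧ 1 (invert-0 (⟦translate⟧ 1
      (invert-unique {b = - + 1} (⟦translate⁻¹⟧ 1 x≋0) ≋-refl)))) ≋-refl)

  reflection-1 : ∀ {x} → ⟦ x ⟧ ≋ + 1 → ⟦ reflection x ⟧ ≋ + 1
  reflection-1 x≋1 =
    ⟦translate⟧ 1 (invert-0 (⟦translate⁻¹⟧ 1 (invert-unique {b = + 1} (⟦translate⟧ 1
      (invert-0 (⟦translate⁻¹⟧ 1 x≋1))) ≋-refl)))

  reflection-generic : ∀ {x} → ¬ ⟦ x ⟧ ≋ + 0 → ¬ ⟦ x ⟧ ≋ + 1 → ⟦ reflection x ⟧ ≋ + 1 - ⟦ x ⟧
  reflection-generic {x} x≉0 x≉1 = ≋-trans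
    (⟦translate⟧ 1 (invert-unique (⟦translate⁻¹⟧ 1 (invert-unique (⟦translate⟧ 1 (≋-refl {u})) step₄)) step₆))
    (≋-reflexive (ℤ.+-comm (- X) (+ 1)))
    where
    X = ⟦ x ⟧
    v = ⟦ invert x ⟧
    Xv≋1 : X * v ≋ + 1
    Xv≋1 = invert-inverse ≋-refl x≉0
    u = ⟦ invert (translate⁻¹ 1 x) ⟧
    [X-1]u≋1 : (X - + 1) * u ≋ + 1
    [X-1]u≋1 = invert-inverse (⟦translate⁻¹⟧ 1 {x} ≋-refl) (a≉k⇒a-k≉0 1 x≉1)
    step₄ : (u + + 1) * ((X - + 1) * v) ≋ + 1
    step₄ = ≋-from-combination v (+ 1) [X-1]u≋1 Xv≋1 (identity u X v)
      where
      identity : ∀ u X v → (u + + 1) * ((X - + 1) * v) - + 1 ≡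
                           v * ((X - + 1) * u - + 1) + + 1 * (X * v - + 1)
      identity = solve-∀
    step₆ : ((X - + 1) * v - + 1) * - X ≋ + 1
    step₆ = ≋-from-multiple (- (X - + 1)) Xv≋1 (identity X v)
      where
      identity : ∀ X v → ((X - + 1) * v - + 1) * - X - + 1 ≡ - (X - + 1) * (X * v - + 1)
      identity = solve-∀

  -- Away from 0, 1 and 2 this acts as
  -- x ↦ x - 2 ↦ 1/(x - 2) ↦ (x - 1)/(x - 2) ↦ (x - 2)/(x - 1) ↦ -x/(x - 1) ↦ -(x - 1)/x ↦ 1/x ↦ x.
  three-cycle : Fin p → Fin p
  three-cycle = word (invert ∷ translate 1 ∷ invert ∷ translate⁻¹ 2 ∷
                      invert ∷ translate 1 ∷ invert ∷ translate⁻¹ 2 ∷ [])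

  three-cycle∈G : InG p three-cycle
  three-cycle∈G = word∈G (invert∈G ∷ translate∈G 1 ∷ invert∈G ∷ translate∈G _ ∷
                          invert∈G ∷ translate∈G 1 ∷ invert∈G ∷ translate∈G _ ∷ [])

  private
    half : ℤ
    half = ⟦ invert (ι 2) ⟧

    2*half≋1 : + 2 * half ≋ + 1
    2*half≋1 = invert-inverse (⟦ι⟧ 2) λ 2≋0 → contradiction (≋-canonical 2<p (s≤s z≤n) 2≋0) (λ ())

    [-2]*[-half]≋1 : - + 2 * - half ≋ + 1
    [-2]*[-half]≋1 = ≋-from-multiple (+ 1) 2*half≋1 (identity half)
      where
      identity : ∀ h → - + 2 * - h - + 1 ≡ + 1 * (+ 2 * h - + 1)
      identity = solve-∀

    [1-half]*2≋1 : (- half + + 1) * + 2 ≋ + 1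
    [1-half]*2≋1 = ≋-from-multiple (- + 1) 2*half≋1 (identity half)
      where
      identity : ∀ h → (- h + + 1) * + 2 - + 1 ≡ - + 1 * (+ 2 * h - + 1)
      identity = solve-∀

  three-cycle-0 : ∀ {x} → ⟦ x ⟧ ≋ + 0 → ⟦ three-cycle x ⟧ ≋ + 1
  three-cycle-0 x≋0 =
    invert-unique {b = + 1} (⟦translate⟧ 1 (invert-0 (⟦translate⁻¹⟧ 2 (invert-unique {b = + 2} (⟦translate⟧ 1
      (invert-unique {b = - half} (⟦translate⁻¹⟧ 2 x≋0) [-2]*[-half]≋1)) [1-half]*2≋1)))) ≋-refl

  three-cycle-1 : ∀ {x} → ⟦ x ⟧ ≋ + 1 → ⟦ three-cycle x ⟧ ≋ + 2
  three-cycle-1 x≋1 =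
    invert-unique {b = + 2} (⟦translate⟧ 1 (invert-unique {b = - half} (⟦translate⁻¹⟧ 2 (invert-0 (⟦translate⟧ 1
      (invert-unique {b = - + 1} (⟦translate⁻¹⟧ 2 x≋1) ≋-refl)))) [-2]*[-half]≋1)) [1-half]*2≋1

  three-cycle-2 : ∀ {x} → ⟦ x ⟧ ≋ + 2 → ⟦ three-cycle x ⟧ ≋ + 0
  three-cycle-2 x≋2 =
    invert-0 (⟦translate⟧ 1 (invert-unique {b = - + 1} (⟦translate⁻¹⟧ 2 (invert-unique {b = + 1} (⟦translate⟧ 1
      (invert-0 (⟦translate⁻¹⟧ 2 x≋2))) ≋-refl)) ≋-refl))

  three-cycle-generic : ∀ {x} → ¬ ⟦ x ⟧ ≋ + 0 → ¬ ⟦ x ⟧ ≋ + 1 → ¬ ⟦ x ⟧ ≋ + 2 → three-cycle x ≡ x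
  three-cycle-generic {x} x≉0 x≉1 x≉2 = ⟦⟧-injective
    (invert-unique (⟦translate⟧ 1 (invert-unique (⟦translate⁻¹⟧ 2
      (invert-unique (⟦translate⟧ 1 (≋-refl {a})) step₄)) step₆)) step₈)
    where
    X = ⟦ x ⟧
    v = ⟦ invert x ⟧
    Xv≋1 : X * v ≋ + 1
    Xv≋1 = invert-inverse ≋-refl x≉0
    w = ⟦ invert (translate⁻¹ 1 x) ⟧
    [X-1]w≋1 : (X - + 1) * w ≋ + 1
    [X-1]w≋1 = invert-inverse (⟦translate⁻¹⟧ 1 {x} ≋-refl) (a≉k⇒a-k≉0 1 x≉1)
    a = ⟦ invert (translate⁻¹ 2 x) ⟧
    [X-2]a≋1 : (X - + 2) * a ≋ + 1
    [X-2]a≋1 = invert-inverse (⟦translate⁻¹⟧ 2 {x} ≋-refl) (a≉k⇒a-k≉0 2 x≉2)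
    step₄ : (a + + 1) * ((X - + 2) * w) ≋ + 1
    step₄ = ≋-from-combination w (+ 1) [X-2]a≋1 [X-1]w≋1 (identity a X w)
      where
      identity : ∀ a X w → (a + + 1) * ((X - + 2) * w) - + 1 ≡
                           w * ((X - + 2) * a - + 1) + + 1 * ((X - + 1) * w - + 1)
      identity = solve-∀
    step₆ : ((X - + 2) * w - + 2) * (- (X - + 1) * v) ≋ + 1
    step₆ = ≋-from-combination (- (X - + 2) * v) (+ 1) [X-1]w≋1 Xv≋1 (identity X w v)
      where
      identity : ∀ X w v → ((X - + 2) * w - + 2) * (- (X - + 1) * v) - + 1 ≡
                           (- (X - + 2) * v) * ((X - + 1) * w - + 1) + + 1 * (X * v - + 1)
      identity = solve-∀
    step₈ : (- (X - + 1) * v + + 1) * X ≋ + 1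
    step₈ = ≋-from-multiple (- (X - + 1)) Xv≋1 (identity X v)
      where
      identity : ∀ X v → (- (X - + 1) * v + + 1) * X - + 1 ≡ - (X - + 1) * (X * v - + 1)
      identity = solve-∀

  opaque
    swap : ℕ → ℕ → Fin p → Fin p
    swap a b = transpose (ι a) (ι b)

    swap-involutive : ∀ a b x → swap a b (swap a b x) ≡ x
    swap-involutive a b = transpose-involutive (ι a) (ι b)

    swap-left : ∀ a b → swap a b (ι a) ≡ ι b
    swap-left a b = transpose-left (ι a) (ι b)

    swap-right : ∀ a b → swap a b (ι b) ≡ ι a
    swap-right a b = transpose-right (ι a) (ι b)

    swap-apart : ∀ {a b x} → a ℕ.< p → b ℕ.< p → toℕ x ≢ a → toℕ x ≢ b → swap a b x ≡ x
    swap-apart a<p b<p x≢a x≢b = transpose-apart (≢ι a<p x≢a) (≢ι b<p x≢b)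

    swap-comm : ∀ a b x → swap a b x ≡ swap b a x
    swap-comm a b = transpose-comm (ι a) (ι b)

    swap-self : ∀ a x → swap a a x ≡ x
    swap-self a = transpose-same (ι a)

    transpose≗swap : ∀ (i j : Fin p) x → transpose i j x ≡ swap (toℕ i) (toℕ j) x
    transpose≗swap i j x = cong₂ (λ i j → transpose i j x) (sym (ι-toℕ i)) (sym (ι-toℕ j))

    swap-conj : ∀ (σ σ⁻¹ : Fin p → Fin p) → (∀ x → σ⁻¹ (σ x) ≡ x) → (∀ x → σ (σ⁻¹ x) ≡ x) →
                ∀ {a b a′ b′} → σ (ι a) ≡ ι a′ → σ (ι b) ≡ ι b′ →
                ∀ x → σ (swap a b (σ⁻¹ x)) ≡ swap a′ b′ x
    swap-conj σ σ⁻¹ left right {a} {b} σa σb x =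
      trans (transpose-conj σ σ⁻¹ left right (ι a) (ι b) x) (cong₂ (λ i j → transpose i j x) σa σb)

  swap²-conj : ∀ (σ σ⁻¹ : Fin p → Fin p) → (∀ x → σ⁻¹ (σ x) ≡ x) → (∀ x → σ (σ⁻¹ x) ≡ x) →
               ∀ {a b c d a′ b′ c′ d′} → σ (ι a) ≡ ι a′ → σ (ι b) ≡ ι b′ → σ (ι c) ≡ ι c′ → σ (ι d) ≡ ι d′ →
               ∀ x → σ (swap a b (swap c d (σ⁻¹ x))) ≡ swap a′ b′ (swap c′ d′ x)
  swap²-conj σ σ⁻¹ left right {a} {b} {c} {d} {a′} {b′} {c′} {d′} σa σb σc σd x = begin
    σ (swap a b (swap c d (σ⁻¹ x)))              ≡⟨ cong (σ ∘ swap a b) (left _) ⟨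
    σ (swap a b (σ⁻¹ (σ (swap c d (σ⁻¹ x)))))    ≡⟨ swap-conj σ σ⁻¹ left right σa σb _ ⟩
    swap a′ b′ (σ (swap c d (σ⁻¹ x)))            ≡⟨ cong (swap a′ b′) (swap-conj σ σ⁻¹ left right σc σd x) ⟩
    swap a′ b′ (swap c′ d′ x) ∎
    where open ≡-Reasoning

  swap²-cancel : ∀ a b c d x → swap a b (swap c d (swap c d (swap a b x))) ≡ x
  swap²-cancel a b c d x = trans (cong (swap a b) (swap-involutive c d (swap a b x))) (swap-involutive a b x)

  shift : ℕ → (Fin p → Fin p) → Fin p → Fin p
  shift k f = translate k ∘ f ∘ translate⁻¹ k

  shift∈G : ∀ k {f} → InG p f → InG p (shift k f)
  shift∈G k = ∈G-conj (translate⁻¹ k) (translate∈G k) (translate⁻¹-translate k) (translate-translate⁻¹ k)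

  swap∈G-shift : ∀ k {a b} → InG p (swap a b) → InG p (swap (a ℕ.+ k) (b ℕ.+ k))
  swap∈G-shift k {a} {b} ab∈G = ext (shift∈G k ab∈G)
    (swap-conj (translate k) (translate⁻¹ k) (translate⁻¹-translate k) (translate-translate⁻¹ k)
      (translate-ι k a) (translate-ι k b))

  swap²∈G-shift : ∀ k {a b c d} → InG p (swap a b ∘ swap c d) →
                  InG p (swap (a ℕ.+ k) (b ℕ.+ k) ∘ swap (c ℕ.+ k) (d ℕ.+ k))
  swap²∈G-shift k {a} {b} {c} {d} abcd∈G = ext (shift∈G k abcd∈G)
    (swap²-conj (translate k) (translate⁻¹ k) (translate⁻¹-translate k) (translate-translate⁻¹ k)
      (translate-ι k a) (translate-ι k b) (translate-ι k c) (translate-ι k d))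

  swap∈G-unshift : ∀ k {a b} → InG p (swap (a ℕ.+ k) (b ℕ.+ k)) → InG p (swap a b)
  swap∈G-unshift k {a} {b} ab∈G =
    ext (∈G-conj (translate k) (translate∈G _) (translate-translate⁻¹ k) (translate⁻¹-translate k) ab∈G)
        (swap-conj (translate⁻¹ k) (translate k) (translate-translate⁻¹ k) (translate⁻¹-translate k)
          (translate⁻¹-ι k a) (translate⁻¹-ι k b))

  cycle : ℕ → Fin p → Fin p
  cycle k = swap k (1 ℕ.+ k) ∘ swap (1 ℕ.+ k) (2 ℕ.+ k)

  module _ {k} (2+k<p : 2 ℕ.+ k ℕ.< p) where
    private
      1+k<p = ℕ.<-trans (ℕ.n<1+n _) 2+k<p
      k<p = ℕ.<-trans (ℕ.n<1+n _) 1+k<p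

    cycle-first : cycle k (ι k) ≡ ι (1 ℕ.+ k)
    cycle-first = trans (cong (swap k (1 ℕ.+ k)) (swap-apart 1+k<p 2+k<p k≢1+k k≢2+k)) (swap-left k (1 ℕ.+ k))
      where
      k≢1+k = ι-apart k<p (ℕ.m≢1+n+m k {0})
      k≢2+k = ι-apart k<p (ℕ.m≢1+n+m k {1})

    cycle-second : cycle k (ι (1 ℕ.+ k)) ≡ ι (2 ℕ.+ k)
    cycle-second = trans (cong (swap k (1 ℕ.+ k)) (swap-left (1 ℕ.+ k) (2 ℕ.+ k))) (swap-apart k<p 1+k<p 2+k≢k 2+k≢1+k)
      where
      2+k≢k = ι-apart 2+k<p (≢-sym (ℕ.m≢1+n+m k {1}))
      2+k≢1+k = ι-apart 2+k<p (≢-sym (ℕ.m≢1+n+m (1 ℕ.+ k) {0}))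

    cycle-third : cycle k (ι (2 ℕ.+ k)) ≡ ι k
    cycle-third = trans (cong (swap k (1 ℕ.+ k)) (swap-right (1 ℕ.+ k) (2 ℕ.+ k))) (swap-right k (1 ℕ.+ k))

    cycle-fixes : ∀ {x} → toℕ x ≢ k → toℕ x ≢ 1 ℕ.+ k → toℕ x ≢ 2 ℕ.+ k → cycle k x ≡ x
    cycle-fixes x≢k x≢1+k x≢2+k =
      trans (cong (swap k (1 ℕ.+ k)) (swap-apart 1+k<p 2+k<p x≢1+k x≢2+k)) (swap-apart k<p 1+k<p x≢k x≢1+k)

    cycle-apart : ∀ {c} → c ℕ.< p → c ≢ k → c ≢ 1 ℕ.+ k → c ≢ 2 ℕ.+ k → cycle k (ι c) ≡ ι c
    cycle-apart c<p c≢k c≢1+k c≢2+k = cycle-fixes (ι-apart c<p c≢k) (ι-apart c<p c≢1+k) (ι-apart c<p c≢2+k)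

  three-cycle≗cycle0 : ∀ x → three-cycle x ≡ cycle 0 x
  three-cycle≗cycle0 x@Fin.zero = begin
    three-cycle x    ≡⟨ ≋⇒≡ι (three-cycle-0 ≋-refl) ⟩
    ι 1              ≡⟨ cycle-first 2<p ⟨
    cycle 0 (ι 0)    ≡⟨ cong (cycle 0) (ι-toℕ x) ⟩
    cycle 0 x ∎
    where open ≡-Reasoning
  three-cycle≗cycle0 x@(Fin.suc Fin.zero) = begin
    three-cycle x    ≡⟨ ≋⇒≡ι (three-cycle-1 ≋-refl) ⟩
    ι 2              ≡⟨ cycle-second 2<p ⟨
    cycle 0 (ι 1)    ≡⟨ cong (cycle 0) (ι-toℕ x) ⟩
    cycle 0 x ∎
    where open ≡-Reasoning
  three-cycle≗cycle0 x@(Fin.suc (Fin.suc Fin.zero)) = begin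
    three-cycle x    ≡⟨ ≋⇒≡ι (three-cycle-2 ≋-refl) ⟩
    ι 0              ≡⟨ cycle-third 2<p ⟨
    cycle 0 (ι 2)    ≡⟨ cong (cycle 0) (ι-toℕ x) ⟩
    cycle 0 x ∎
    where open ≡-Reasoning
  three-cycle≗cycle0 x@(Fin.suc (Fin.suc (Fin.suc y))) = begin
    three-cycle x        ≡⟨ three-cycle-generic (>⇒≉ ℕ.z<s) (>⇒≉ (ℕ.s<s ℕ.z<s)) (>⇒≉ (ℕ.s<s (ℕ.s<s ℕ.z<s))) ⟩
    x                    ≡⟨ cycle-fixes 2<p (λ ()) (λ ()) (λ ()) ⟨
    cycle 0 x ∎
    where open ≡-Reasoning

  cycle∈G : ∀ k → InG p (cycle k)
  cycle∈G k = swap²∈G-shift k (ext three-cycle∈G three-cycle≗cycle0)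

  cycle⁻¹ : ℕ → Fin p → Fin p
  cycle⁻¹ k = swap (1 ℕ.+ k) (2 ℕ.+ k) ∘ swap k (1 ℕ.+ k)

  cycle⁻¹-cycle : ∀ k x → cycle⁻¹ k (cycle k x) ≡ x
  cycle⁻¹-cycle k = swap²-cancel (1 ℕ.+ k) (2 ℕ.+ k) k (1 ℕ.+ k)

  cycle-cycle⁻¹ : ∀ k x → cycle k (cycle⁻¹ k x) ≡ x
  cycle-cycle⁻¹ k = swap²-cancel k (1 ℕ.+ k) (1 ℕ.+ k) (2 ℕ.+ k)

  cycle⁻¹∈G : ∀ k → InG p (cycle⁻¹ k)
  cycle⁻¹∈G k = inv (cycle∈G k) (cycle⁻¹-cycle k) (cycle-cycle⁻¹ k)

  ∈G-conj-cycle : ∀ k {f} → InG p f → InG p (cycle k ∘ f ∘ cycle⁻¹ k)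
  ∈G-conj-cycle k = ∈G-conj (cycle⁻¹ k) (cycle∈G k) (cycle⁻¹-cycle k) (cycle-cycle⁻¹ k)

  ∈G-conj-cycle⁻¹ : ∀ k {f} → InG p f → InG p (cycle⁻¹ k ∘ f ∘ cycle k)
  ∈G-conj-cycle⁻¹ k = ∈G-conj (cycle k) (cycle⁻¹∈G k) (cycle-cycle⁻¹ k) (cycle⁻¹-cycle k)

  cycle⁻¹-of : ∀ {k x y} → cycle k x ≡ y → cycle⁻¹ k y ≡ x
  cycle⁻¹-of {k} {x} refl = cycle⁻¹-cycle k x

  outer-pair : ℕ → Fin p → Fin p
  outer-pair j = swap 0 (3 ℕ.+ j) ∘ swap 1 (2 ℕ.+ j)

  outer-pair∈G : ∀ j → 3 ℕ.+ j ℕ.< p → InG p (outer-pair j)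
  outer-pair∈G zero 3<p = ext (∈G-conj-cycle⁻¹ 1 [01][23]∈G)
    (swap²-conj (cycle⁻¹ 1) (cycle 1) (cycle-cycle⁻¹ 1) (cycle⁻¹-cycle 1)
      (cycle⁻¹-of (cycle-apart 3<p (s≤s z≤n) (λ ()) (λ ()) (λ ())))
      (cycle⁻¹-of (cycle-third 3<p))
      (cycle⁻¹-of (cycle-first 3<p))
      (cycle⁻¹-of (cycle-second 3<p)))
    where
    [01][23]∈G : InG p (swap 0 1 ∘ swap 2 3)
    [01][23]∈G = ext (comp (cycle∈G 0) (cycle∈G 1))
                     (λ x → cong (swap 0 1) (swap-involutive 1 2 (swap 2 3 x)))
  outer-pair∈G (suc j) 4+j<p = ext (∈G-conj-cycle (2 ℕ.+ j) (outer-pair∈G j 3+j<p))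
    (swap²-conj (cycle (2 ℕ.+ j)) (cycle⁻¹ (2 ℕ.+ j)) (cycle⁻¹-cycle _) (cycle-cycle⁻¹ _)
      (cycle-apart 4+j<p (s≤s z≤n) (λ ()) (λ ()) (λ ()))
      (cycle-second 4+j<p)
      (cycle-apart 4+j<p (s≤s (s≤s z≤n)) (λ ()) (λ ()) (λ ()))
      (cycle-first 4+j<p))
    where
    3+j<p = ℕ.<-trans (ℕ.n<1+n _) 4+j<p

  reversal : ℕ → ℕ → Fin p → Fin p
  reversal l zero = id
  reversal l (suc zero) = id
  reversal l (suc (suc n)) = swap l (l ℕ.+ suc n) ∘ reversal (suc l) n

  reversal-outside : ∀ n l {x} → l ℕ.+ n ℕ.≤ p → toℕ x ℕ.< l ⊎ l ℕ.+ n ℕ.≤ toℕ x →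
                     reversal l n x ≡ x
  reversal-outside zero l _ _ = refl
  reversal-outside (suc zero) l _ _ = refl
  reversal-outside (suc (suc n)) l {x} bound outside =
    trans (cong (swap l (l ℕ.+ suc n)) (reversal-outside n (suc l) bound′ outside′))
          (swap-apart l<p end<p x≢l x≢end)
    where
    end<end+1 : l ℕ.+ suc n ℕ.< l ℕ.+ suc (suc n)
    end<end+1 = ℕ.+-monoʳ-< l ℕ.≤-refl
    end<p : l ℕ.+ suc n ℕ.< p
    end<p = ℕ.<-≤-trans end<end+1 bound
    l<p : l ℕ.< p
    l<p = ℕ.≤-<-trans (ℕ.m≤m+n l (suc n)) end<p
    bound′ : suc l ℕ.+ n ℕ.≤ p
    bound′ = subst (ℕ._≤ p) (ℕ.+-suc l n) (ℕ.<⇒≤ end<p)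
    outside′ : toℕ x ℕ.< suc l ⊎ suc l ℕ.+ n ℕ.≤ toℕ x
    outside′ = Sum.map ℕ.m<n⇒m<1+n
                       (ℕ.≤-trans (subst (ℕ._≤ l ℕ.+ suc (suc n)) (ℕ.+-suc l n) (ℕ.<⇒≤ end<end+1)))
                       outside
    x≢l : toℕ x ≢ l
    x≢l = Sum.[ ℕ.<⇒≢ , (λ l+2+n≤x → ≢-sym (ℕ.<⇒≢ (ℕ.<-≤-trans (ℕ.m<m+n l ℕ.z<s) l+2+n≤x))) ] outside
    x≢end : toℕ x ≢ l ℕ.+ suc n
    x≢end = Sum.[ (λ x<l → ℕ.<⇒≢ (ℕ.<-≤-trans x<l (ℕ.m≤m+n l (suc n))))
                , (λ l+2+n≤x → ≢-sym (ℕ.<⇒≢ (ℕ.<-≤-trans end<end+1 l+2+n≤x))) ] outside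

  module _ {l m : ℕ} (bound : l ℕ.+ suc (suc m) ℕ.≤ p) where
    private
      end = l ℕ.+ suc m
      end<p : end ℕ.< p
      end<p = ℕ.<-≤-trans (ℕ.+-monoʳ-< l ℕ.≤-refl) bound
      l<p : l ℕ.< p
      l<p = ℕ.≤-<-trans (ℕ.m≤m+n l (suc m)) end<p
      bound′ : suc l ℕ.+ m ℕ.≤ p
      bound′ = subst (ℕ._≤ p) (ℕ.+-suc l m) (ℕ.<⇒≤ end<p)

    reversal-first : ∀ {x} → toℕ x ≡ l → toℕ (reversal l (suc (suc m)) x) ≡ end
    reversal-first {x} x≡l = begin
      toℕ (swap l end (reversal (suc l) m x)) ≡⟨ cong (toℕ ∘ swap l end) (reversal-outside m (suc l) bound′ x<1+l) ⟩
      toℕ (swap l end x)                       ≡⟨ cong (toℕ ∘ swap l end) (≡ι x≡l) ⟩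
      toℕ (swap l end (ι l))                   ≡⟨ cong toℕ (swap-left l end) ⟩
      toℕ (ι end)                              ≡⟨ toℕ-ι end<p ⟩
      end ∎
      where
      open ≡-Reasoning
      x<1+l = inj₁ (s≤s (ℕ.≤-reflexive x≡l))

    reversal-last : ∀ {x} → toℕ x ≡ end → toℕ (reversal l (suc (suc m)) x) ≡ l
    reversal-last {x} x≡end = begin
      toℕ (swap l end (reversal (suc l) m x)) ≡⟨ cong (toℕ ∘ swap l end) (reversal-outside m (suc l) bound′ 1+l+m≤x) ⟩
      toℕ (swap l end x)                       ≡⟨ cong (toℕ ∘ swap l end) (≡ι x≡end) ⟩
      toℕ (swap l end (ι end))                 ≡⟨ cong toℕ (swap-right l end) ⟩
      toℕ (ι l)                                ≡⟨ toℕ-ι l<p ⟩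
      l ∎
      where
      open ≡-Reasoning
      1+l+m≤x = inj₂ (ℕ.≤-reflexive (trans (sym (ℕ.+-suc l m)) (sym x≡end)))

  reversal-inside : ∀ n l {x} → l ℕ.+ suc n ℕ.≤ p → l ℕ.≤ toℕ x → toℕ x ℕ.≤ l ℕ.+ n →
                    toℕ (reversal l (suc n) x) ℕ.+ toℕ x ≡ l ℕ.+ (l ℕ.+ n)

  reversal-interior : ∀ m l {x} → l ℕ.+ suc (suc m) ℕ.≤ p → l ℕ.< toℕ x → toℕ x ℕ.< l ℕ.+ suc m →
                      toℕ (reversal l (suc (suc m)) x) ℕ.+ toℕ x ≡ l ℕ.+ (l ℕ.+ suc m)

  reversal-inside zero l {x} _ l≤x x≤l+0 rewrite ℕ.+-identityʳ l | ℕ.≤-antisym x≤l+0 l≤x = refl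
  reversal-inside (suc m) l {x} bound l≤x x≤end with toℕ x ℕ.≟ l | toℕ x ℕ.≟ l ℕ.+ suc m
  ... | yes x≡l | _ = trans (cong₂ ℕ._+_ (reversal-first bound x≡l) x≡l) (ℕ.+-comm (l ℕ.+ suc m) l)
  ... | no _ | yes x≡end = cong₂ ℕ._+_ (reversal-last bound x≡end) x≡end
  ... | no x≢l | no x≢end =
    reversal-interior m l bound (ℕ.≤∧≢⇒< l≤x (≢-sym x≢l)) (ℕ.≤∧≢⇒< x≤end x≢end)

  reversal-interior zero l {x} _ l<x x<l+1 =
    contradiction (ℕ.≤-pred (subst (toℕ x ℕ.<_) (ℕ.+-comm l 1) x<l+1)) (ℕ.<⇒≱ l<x)
  reversal-interior (suc m) l {x} bound l<x x<end = begin
    toℕ (swap l end y) ℕ.+ toℕ x    ≡⟨ cong (λ z → toℕ z ℕ.+ toℕ x) (swap-apart l<p end<p y≢l y≢end) ⟩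
    toℕ y ℕ.+ toℕ x                 ≡⟨ y+x≡S ⟩
    l ℕ.+ end ∎
    where
    open ≡-Reasoning
    end = l ℕ.+ suc (suc m)
    y = reversal (suc l) (suc m) x
    end<p : end ℕ.< p
    end<p = ℕ.<-≤-trans (ℕ.+-monoʳ-< l ℕ.≤-refl) bound
    l<p : l ℕ.< p
    l<p = ℕ.≤-<-trans (ℕ.m≤m+n l _) end<p
    y+x≡S : toℕ y ℕ.+ toℕ x ≡ l ℕ.+ end
    y+x≡S = trans (reversal-inside m (suc l) bound′ l<x x≤l+1+m) (identity l m)
      where
      bound′ : suc l ℕ.+ suc m ℕ.≤ p
      bound′ = ℕ.<⇒≤ (subst (ℕ._< p) (ℕ.+-suc l (suc m)) end<p)
      x≤l+1+m : toℕ x ℕ.≤ suc l ℕ.+ m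
      x≤l+1+m = subst (toℕ x ℕ.≤_) (ℕ.+-suc l m) (ℕ.≤-pred (subst (toℕ x ℕ.<_) (ℕ.+-suc l (suc m)) x<end))
      identity : ∀ l m → suc l ℕ.+ (suc l ℕ.+ m) ≡ l ℕ.+ (l ℕ.+ suc (suc m))
      identity = ℕ-Solver.solve-∀
    y≢l : toℕ y ≢ l
    y≢l y≡l = ℕ.<⇒≢ x<end (ℕ.+-cancelˡ-≡ l _ _ (trans (cong (ℕ._+ toℕ x) (sym y≡l)) y+x≡S))
    y≢end : toℕ y ≢ end
    y≢end y≡end =
      ℕ.<⇒≢ l<x (sym (ℕ.+-cancelˡ-≡ end _ _ (trans (cong (ℕ._+ toℕ x) (sym y≡end)) (trans y+x≡S (ℕ.+-comm l end)))))

  ≗-reversal : ∀ {f : Fin p → Fin p} n l → l ℕ.+ suc n ≡ p → (∀ x → toℕ x ℕ.< l → f x ≡ x) →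
               (∀ x → l ℕ.≤ toℕ x → ⟦ f x ⟧ + ⟦ x ⟧ ≋ + (l ℕ.+ (l ℕ.+ n))) →
               ∀ x → f x ≡ reversal l (suc n) x
  ≗-reversal {f} n l l+1+n≡p fixes reflects x with l ℕ.≤? toℕ x
  ... | no x≱l = trans (fixes x x<l) (sym (reversal-outside (suc n) l (ℕ.≤-reflexive l+1+n≡p) (inj₁ x<l)))
    where x<l = ℕ.≰⇒> x≱l
  ... | yes l≤x = ⟦⟧-injective
    (≋-from-combination (+ 1) (- + 1) (reflects x l≤x) (≋-reflexive rev+x≡S) (identity ⟦ f x ⟧ ⟦ x ⟧ ⟦ rev x ⟧ S))
    where
    rev = reversal l (suc n)
    S = + (l ℕ.+ (l ℕ.+ n))
    x≤l+n : toℕ x ℕ.≤ l ℕ.+ n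
    x≤l+n = ℕ.≤-pred (subst (toℕ x ℕ.<_) (trans (sym l+1+n≡p) (ℕ.+-suc l n)) (toℕ<n x))
    rev+x≡S : ⟦ rev x ⟧ + ⟦ x ⟧ ≡ S
    rev+x≡S = trans (sym (pos-+ (toℕ (rev x)) (toℕ x)))
                    (cong +_ (reversal-inside n l (ℕ.≤-reflexive l+1+n≡p) l≤x x≤l+n))
    identity : ∀ a b c S → a - c ≡ + 1 * ((a + b) - S) + - + 1 * ((c + b) - S)
    identity = solve-∀

  negate≗reversal : ∀ x → negate x ≡ reversal 1 (p ℕ.∸ 1) x
  negate≗reversal = ≗-reversal (suc r) 1 refl fixes reflects
    where
    fixes : ∀ x → toℕ x ℕ.< 1 → negate x ≡ x
    fixes Fin.zero _ = ⟦⟧-injective (⟦negate⟧ Fin.zero)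
    fixes (Fin.suc _) (s≤s ())
    reflects : ∀ x → 1 ℕ.≤ toℕ x → ⟦ negate x ⟧ + ⟦ x ⟧ ≋ + p
    reflects x _ = ≋-trans (+-cong (⟦negate⟧ x) ≋-refl) (≋-trans (≋-reflexive (ℤ.+-inverseˡ ⟦ x ⟧)) (≋-sym n≋0))

  reflection≗reversal : ∀ x → reflection x ≡ reversal 2 (p ℕ.∸ 2) x
  reflection≗reversal = ≗-reversal r 2 refl fixes reflects
    where
    fixes : ∀ x → toℕ x ℕ.< 2 → reflection x ≡ x
    fixes Fin.zero _ = ⟦⟧-injective (reflection-0 ≋-refl)
    fixes (Fin.suc Fin.zero) _ = ⟦⟧-injective (reflection-1 ≋-refl)
    fixes (Fin.suc (Fin.suc _)) (s≤s (s≤s ()))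
    reflects : ∀ x → 2 ℕ.≤ toℕ x → ⟦ reflection x ⟧ + ⟦ x ⟧ ≋ + (2 ℕ.+ (2 ℕ.+ r))
    reflects x 2≤x = begin
      ⟦ reflection x ⟧ + ⟦ x ⟧    ≈⟨ +-cong (reflection-generic {x} (>⇒≉ (ℕ.<-≤-trans ℕ.z<s 2≤x)) (>⇒≉ 2≤x)) ≋-refl ⟩
      + 1 - ⟦ x ⟧ + ⟦ x ⟧         ≡⟨ identity ⟦ x ⟧ ⟩
      + 1 + + 0                   ≈⟨ +-cong (≋-refl {+ 1}) n≋0 ⟨
      + 1 + + p                   ≡⟨ pos-+ 1 p ⟨
      + (1 ℕ.+ p) ∎
      where
      open import Relation.Binary.Reasoning.Setoid ≋-setoid
      identity : ∀ a → + 1 - a + a ≡ + 1 + + 0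
      identity = solve-∀

  descent : ∀ l n → 3 ℕ.+ n ℕ.< p → InG p (reversal l (4 ℕ.+ n)) → InG p (reversal (2 ℕ.+ l) n)
  descent l n 3+n<p reversal∈G =
    ext (comp (∈G-reverse {f = swap l a} {g = swap (suc l) b}
                          (swap-involutive l a) (swap-involutive (suc l) b) outer∈G)
              reversal∈G)
        (swap²-cancel (suc l) b l a ∘ reversal (2 ℕ.+ l) n)
    where
    a = l ℕ.+ (3 ℕ.+ n)
    b = suc l ℕ.+ suc n
    outer∈G : InG p (swap l a ∘ swap (suc l) b)
    outer∈G = subst₂ (λ a b → InG p (swap l a ∘ swap (suc l) b)) (ℕ.+-comm (3 ℕ.+ n) l)
      (cong suc (trans (cong suc (ℕ.+-comm n l)) (sym (ℕ.+-suc l n))))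
      (swap²∈G-shift l (outer-pair∈G n 3+n<p))

  descents : ∀ q l n → q ℕ.* 4 ℕ.+ n ℕ.≤ p →
             InG p (reversal l (q ℕ.* 4 ℕ.+ n)) → InG p (reversal (q ℕ.* 2 ℕ.+ l) n)
  descents zero l n _ reversal∈G = reversal∈G
  descents (suc q) l n bound reversal∈G =
    subst (λ k → InG p (reversal k n)) (trans (ℕ.+-suc _ _) (cong suc (ℕ.+-suc _ _)))
      (descents q (2 ℕ.+ l) n (ℕ.≤-trans (ℕ.m≤n+m _ 4) bound) (descent l (q ℕ.* 4 ℕ.+ n) bound reversal∈G))

  adjacent-swaps∈G : ∀ {m} → InG p (swap m (1 ℕ.+ m)) → ∀ a → InG p (swap a (1 ℕ.+ a))
  adjacent-swaps∈G {m} m∈G a = swap∈G-shift a (swap∈G-unshift m {0} {1} m∈G)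

  module _ (adjacent∈G : ∀ a → InG p (swap a (1 ℕ.+ a))) where

    swap-at-distance∈G : ∀ d a → suc d ℕ.+ a ℕ.< p → InG p (swap a (suc d ℕ.+ a))
    swap-at-distance∈G zero a _ = adjacent∈G a
    swap-at-distance∈G (suc d) a 2+d+a<p =
      ext (∈G-conj τ (adjacent∈G b) τ-involutive τ-involutive (swap-at-distance∈G d a b<p))
          (swap-conj τ τ τ-involutive τ-involutive (swap-apart b<p 2+d+a<p (ι-apart a<p a≢b) (ι-apart a<p a≢1+b))
                                                   (swap-left b (1 ℕ.+ b)))
      where
      b = suc d ℕ.+ a
      τ = swap b (1 ℕ.+ b)
      τ-involutive = swap-involutive b (1 ℕ.+ b)
      b<p = ℕ.<-trans (ℕ.n<1+n b) 2+d+a<p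
      a<p = ℕ.≤-<-trans (ℕ.m≤n+m a (suc d)) b<p
      a≢b : a ≢ b
      a≢b = ℕ.m≢1+n+m a {d}
      a≢1+b : a ≢ 1 ℕ.+ b
      a≢1+b = ℕ.m≢1+n+m a {suc d}

    ordered-swap∈G : ∀ {a b} → a ℕ.< b → b ℕ.< p → InG p (swap a b)
    ordered-swap∈G {a} a<b b<p with ℕ.m≤n⇒∃[o]m+o≡n a<b
    ... | d , refl = subst (InG p ∘ swap a) (cong suc (ℕ.+-comm d a))
                       (swap-at-distance∈G d a (subst (ℕ._< p) (cong suc (ℕ.+-comm a d)) b<p))

    swap∈G : ∀ {a b} → a ℕ.< p → b ℕ.< p → InG p (swap a b)
    swap∈G {a} {b} a<p b<p with ℕ.<-cmp a b
    ... | tri< a<b _ _ = ordered-swap∈G a<b b<p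
    ... | tri≈ _ refl _ = ext idG (λ x → sym (swap-self a x))
    ... | tri> _ _ b<a = ext (ordered-swap∈G b<a a<p) (swap-comm b a)

    transpose∈G : ∀ i j → InG p (transpose i j)
    transpose∈G i j = ext (swap∈G (toℕ<n i) (toℕ<n j)) (λ x → sym (transpose≗swap i j x))

  adjacent-swap∈G : p % 2 ≡ 1 → InG p (swap 0 1)
  adjacent-swap∈G p-odd with odd⇒r≡4q∨4q+2 r p-odd
  ... | q , inj₁ r≡4q = swap∈G-unshift m (subst (InG p ∘ swap m) (ℕ.+-comm m 1) last∈G)
    where
    m = q ℕ.* 2 ℕ.+ 1
    p%4≡3 : p % 4 ≡ 3
    p%4≡3 = trans (cong (λ n → (3 ℕ.+ n) % 4) r≡4q) ([m+kn]%n≡m%n 3 q 4)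
    length≡ : p ℕ.∸ 1 ≡ q ℕ.* 4 ℕ.+ 2
    length≡ = trans (cong (λ n → suc (suc n)) r≡4q) (ℕ.+-comm 2 (q ℕ.* 4))
    last∈G : InG p (reversal m 2)
    last∈G = descents q 1 2 (subst (ℕ._≤ p) length≡ (ℕ.n≤1+n _))
               (subst (InG p ∘ reversal 1) length≡ (ext (negate∈G p%4≡3) negate≗reversal))
  ... | q , inj₂ r≡4q+2 = ext (∈G-conj-cycle 0 [02]∈G) λ x →
    trans (swap-conj (cycle 0) (cycle⁻¹ 0) (cycle⁻¹-cycle 0) (cycle-cycle⁻¹ 0) (cycle-first 2<p) (cycle-third 2<p) x)
          (swap-comm 1 0 x)
    where
    m = q ℕ.* 2 ℕ.+ 2
    length≡ : p ℕ.∸ 2 ≡ q ℕ.* 4 ℕ.+ 3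
    length≡ = trans (cong suc r≡4q+2) (sym (ℕ.+-suc (q ℕ.* 4) 2))
    last∈G : InG p (reversal m 3)
    last∈G = descents q 2 3 (subst (ℕ._≤ p) length≡ (ℕ.m≤n+m (suc r) 2))
               (subst (InG p ∘ reversal 2) length≡ (ext reflection∈G reflection≗reversal))
    [02]∈G : InG p (swap 0 2)
    [02]∈G = swap∈G-unshift m (subst (InG p ∘ swap m) (ℕ.+-comm m 2) last∈G)

corollary3p6 : (p : ℕ) .{{_ : NonZero p}} → Prime p → p % 2 ≡ 1 →
    (σ : Permutation′ p) → InG p (σ ⟨$⟩ʳ_)
corollary3p6 0 ()
corollary3p6 1 ()
corollary3p6 2 _ ()
corollary3p6 (suc (suc (suc r))) p-prime p-odd =
  permutation∈G (transpose∈G (adjacent-swaps∈G (adjacent-swap∈G p-odd)))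
  where open OddPrime r p-prime
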